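{- One has $B=\bigsqcup_{a,b,c\in\mathbb Z,\ b\le\min\{a,c\}}K_B\begin{pmatrix}\pi^a&\pi^b\\0&\pi^c\end{pmatrix}K_B$, and for all $a,b,c\in\mathbb Z$ with $b\le\min\{a,c\}$: if $b<\min\{a,c\}$, then $K_B\begin{pmatrix}\pi^a&\pi^b\\0&\pi^c\end{pmatrix}K_B=\bigsqcup_{\beta\in A_B\pi^c,\ \operatorname{val}_{\mathfrak F}(\beta)=b}K_B\begin{pmatrix}\pi^a&\beta\\0&\pi^c\end{pmatrix}$; if $b=\min\{a,c\}$, then $K_B\begin{pmatrix}\pi^a&\pi^b\\0&\pi^c\end{pmatrix}K_B=K_B\begin{pmatrix}\pi^a&0\\0&\pi^c\end{pmatrix}K_B=\bigsqcup_{\beta\in A_B\pi^c,\ \operatorname{val}_{\mathfrak F}(\beta)\ge a}K_B\begin{pmatrix}\pi^a&\beta\\0&\pi^c\end{pmatrix}$.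
   Context: $\mathfrak F$ is a non-archimedean local field with normalized valuation $\operatorname{val}_{\mathfrak F}$ (with $\operatorname{val}_{\mathfrak F}(0)=\infty$), valuation ring $\mathcal O_{\mathfrak F}$ and uniformizer $\pi$. $B\subseteq\mathrm{GL}_2(\mathfrak F)$ is the group of invertible upper triangular matrices and $K_B=B\cap\mathrm{GL}_2(\mathcal O_{\mathfrak F})$. $A\subseteq\mathcal O_{\mathfrak F}$ is a complete system of representatives of $\mathcal O_{\mathfrak F}/(\pi)$ with $0\in A$, and $A_B=\{\sum_{i=1}^na_i\pi^{ -i}:n\in\mathbb Z_{>0},a_i\in A\}$ (a system of representatives of $\mathfrak F/\mathcal O_{\mathfrak F}$, containing $0$); $A_B\pi^c=\{\beta\pi^c:\beta\in A_B\}$. -}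

module Defs where

open import Level using (Level; _⊔_) renaming (suc to lsuc)
open import Data.Nat as ℕ using (ℕ; zero; suc)
open import Data.Integer as ℤ using (ℤ; +_; -[1+_])
open import Data.List using (List; []; _∷_)
open import Data.List.Relation.Unary.All using (All)
open import Data.List.Relation.Unary.Any using (Any)
open import Data.Product using (Σ; ∃; _×_; _,_)
open import Relation.Nullary using (¬_)
open import Relation.Binary.PropositionalEquality using (_≡_)
open import Algebra.Bundles using (CommutativeRing)

data ℤ∞ : Set where
  fin : ℤ → ℤ∞
  ∞   : ℤ∞

infix 4 _≤∞_
data _≤∞_ : ℤ∞ → ℤ∞ → Set where
  fin≤fin : ∀ {m n} → m ℤ.≤ n → fin m ≤∞ fin n
  _≤∞∞    : ∀ x → x ≤∞ ∞

_+∞_ : ℤ∞ → ℤ∞ → ℤ∞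
fin m +∞ fin n = fin (m ℤ.+ n)
_     +∞ _     = ∞

min∞ : ℤ∞ → ℤ∞ → ℤ∞
min∞ (fin m) (fin n) = fin (m ℤ.⊓ n)
min∞ (fin m) ∞       = fin m
min∞ ∞       y       = y

-- A non-archimedean local field: a field, complete with respect to a
-- normalized discrete valuation val : 𝔉 → ℤ ∪ {∞} (val π = 1),
-- whose residue field 𝒪/(π) is finite.

record NALocalField (c ℓ : Level) : Set (lsuc (c ⊔ ℓ)) where
  field
    commutativeRing : CommutativeRing c ℓ
  open CommutativeRing commutativeRing public

  _−_ : Carrier → Carrier → Carrier
  x − y = x + (- y)

  field
    -- field structure (x ⁻¹ is only meaningful for x ≉ 0)
    _⁻¹      : Carrier → Carrier
    1≉0      : ¬ (1# ≈ 0#)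
    inverseʳ : ∀ x → ¬ (x ≈ 0#) → x * (x ⁻¹) ≈ 1#
    val      : Carrier → ℤ∞
    val-cong : ∀ {x y} → x ≈ y → val x ≡ val y
    val-∞⇒0  : ∀ x → val x ≡ ∞ → x ≈ 0#
    val-0    : val 0# ≡ ∞
    val-*    : ∀ x y → val (x * y) ≡ val x +∞ val y
    val-+    : ∀ x y → min∞ (val x) (val y) ≤∞ val (x + y)
    π        : Carrier
    val-π    : val π ≡ fin (+ 1)

  InO : Carrier → Set
  InO x = fin (+ 0) ≤∞ val x

  _≡modπ_ : Carrier → Carrier → Set
  x ≡modπ y = fin (+ 1) ≤∞ val (x − y)

  Cauchy : (ℕ → Carrier) → Set
  Cauchy s = ∀ (M : ℤ) → ∃ λ N → ∀ m n → N ℕ.≤ m → N ℕ.≤ n → fin M ≤∞ val (s m − s n)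

  ConvergesTo : (ℕ → Carrier) → Carrier → Set
  ConvergesTo s L = ∀ (M : ℤ) → ∃ λ N → ∀ n → N ℕ.≤ n → fin M ≤∞ val (s n − L)

  field
    residueFinite : ∃ λ (L : List Carrier) → All InO L × (∀ x → InO x → Any (x ≡modπ_) L)
    complete      : ∀ s → Cauchy s → ∃ λ L → ConvergesTo s L

module LF {c ℓ : Level} (𝔉 : NALocalField c ℓ) where
  open NALocalField 𝔉 public

  _^ₙ_ : Carrier → ℕ → Carrier
  x ^ₙ zero  = 1#
  x ^ₙ suc n = x * (x ^ₙ n)

  π^ : ℤ → Carrier
  π^ (+ n)    = π ^ₙ n
  π^ -[1+ n ] = (π ⁻¹) ^ₙ suc n

  record IsRepSystem {p : Level} (A : Carrier → Set p) : Set (c ⊔ ℓ ⊔ p) where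
    field
      zero∈A  : A 0#
      A⊆O     : ∀ a → A a → InO a
      covers  : ∀ x → InO x → ∃ λ a → A a × x ≡modπ a
      unique  : ∀ a a' → A a → A a' → a ≡modπ a' → a ≈ a'

  -- Σ_{i=1}^n a_i π^{-i} for the digit list a_1 ∷ … ∷ a_n (Horner form)
  digits : List Carrier → Carrier
  digits []      = 0#
  digits (a ∷ l) = (π ⁻¹) * (a + digits l)

  InA_B : ∀ {p} (A : Carrier → Set p) → Carrier → Set (c ⊔ ℓ ⊔ p)
  InA_B A x = Σ Carrier λ a₁ → Σ (List Carrier) λ rest →
                A a₁ × All A rest × x ≈ digits (a₁ ∷ rest)

  InA_Bπ^ : ∀ {p} (A : Carrier → Set p) → ℤ → Carrier → Set (c ⊔ ℓ ⊔ p)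
  InA_Bπ^ A k β = Σ Carrier λ α → InA_B A α × β ≈ α * π^ k

  -- upper triangular 2×2 matrices ( x y ; 0 z )
  record UT : Set c where
    constructor ut
    field
      x y z : Carrier

  _·_ : UT → UT → UT
  ut x y z · ut x' y' z' = ut (x * x') (x * y' + y * z') (z * z')

  _≋_ : UT → UT → Set ℓ
  ut x y z ≋ ut x' y' z' = (x ≈ x') × (y ≈ y') × (z ≈ z')

  InB : UT → Set ℓ
  InB (ut x y z) = ¬ (x ≈ 0#) × ¬ (z ≈ 0#)

  inv : UT → UT
  inv (ut x y z) = ut (x ⁻¹) (- (y * ((x ⁻¹) * (z ⁻¹)))) (z ⁻¹)

  -- K_B = B ∩ GL₂(𝒪): in B, entries and entries of the inverse in 𝒪
  EntriesInO : UT → Set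
  EntriesInO (ut x y z) = InO x × InO y × InO z

  InK : UT → Set ℓ
  InK g = InB g × EntriesInO g × EntriesInO (inv g)

  InDC : UT → UT → Set (c ⊔ ℓ)
  InDC g₀ g = Σ UT λ k₁ → Σ UT λ k₂ → InK k₁ × InK k₂ × g ≋ ((k₁ · g₀) · k₂)

  InLC : UT → UT → Set (c ⊔ ℓ)
  InLC g₀ g = Σ UT λ k → InK k × g ≋ (k · g₀)

  M : ℤ → Carrier → ℤ → UT
  M a β c = ut (π^ a) β (π^ c)

-- Write g = ( x y ; 0 z ) ∈ B. Multiplying by elements of K_B on the left and on the right changes
-- x and z by units, and changes y into a unit multiple of y plus an element of π^c 𝒪 (left) or of
-- π^a 𝒪 (right). So K_B g K_B is determined by a = val x, c = val z and the class of y, up to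
-- units, modulo π^min(a,c); that class is represented by π^b with b = min(val y, min(a,c)).
-- A single left coset K_B g is determined by a, c and y modulo π^c once x is normalised to π^a,
-- and the digit expansion over A shows that A_B π^c is a system of representatives of 𝔉 / π^c 𝒪.
-- When b < min(a,c) the strict triangle inequality forces the representative to have valuation b.
module Submission where

open import Defs
open import Level using (Level)
open import Data.Integer using (ℤ; _≤_; _<_; _⊓_)
open import Data.Product using (Σ; _×_)
open import Relation.Binary.PropositionalEquality using (_≡_)
open import Function.Bundles using (_⇔_)

open import Algebra.Bundles using (AbelianGroup; CommutativeRing)
open import Data.Empty using (⊥-elim)
open import Data.Integer as ℤ using (+_; -[1+_]; +≤+)
import Data.Integer.Properties as ℤₚ
open import Data.List using (List; []; _∷_)
open import Data.List.Relation.Unary.All using (All; []; _∷_)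
open import Data.Nat using (ℕ; zero; suc; z≤n)
open import Data.Product using (_,_)
open import Data.Sum using (_⊎_; inj₁; inj₂)
open import Function.Bundles using (Equivalence; mk⇔)
open import Function.Construct.Composition using (_⇔-∘_)
open import Function.Construct.Symmetry using (⇔-sym)
open import Relation.Nullary using (¬_; Dec; yes; no)
import Relation.Binary.PropositionalEquality as ≡

open import Algebra.Properties.Group (AbelianGroup.group ℤₚ.+-0-abelianGroup)
  using (identityˡ-unique; inverseʳ-unique)

fin-injective : ∀ {m n} → fin m ≡ fin n → m ≡ n
fin-injective ≡.refl = ≡.refl

≤∞-trans : ∀ {x y z} → x ≤∞ y → y ≤∞ z → x ≤∞ z
≤∞-trans (fin≤fin p) (fin≤fin q) = fin≤fin (ℤₚ.≤-trans p q)
≤∞-trans {x} _       (_ ≤∞∞)     = x ≤∞∞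

fin≤∞-min∞ : ∀ {k x y} → fin k ≤∞ x → fin k ≤∞ y → fin k ≤∞ min∞ x y
fin≤∞-min∞ (fin≤fin p) (fin≤fin q) = fin≤fin (ℤₚ.⊓-glb p q)
fin≤∞-min∞ (fin≤fin p) (_ ≤∞∞)     = fin≤fin p
fin≤∞-min∞ (_ ≤∞∞)     q           = q

fin≤∞-+∞ : ∀ {k m x y} → fin k ≤∞ x → fin m ≤∞ y → fin (k ℤ.+ m) ≤∞ x +∞ y
fin≤∞-+∞ (fin≤fin p) (fin≤fin q) = fin≤fin (ℤₚ.+-mono-≤ p q)
fin≤∞-+∞ (fin≤fin p) (_ ≤∞∞)     = _ ≤∞∞
fin≤∞-+∞ (_ ≤∞∞)     _           = _ ≤∞∞

+∞-identityˡ : ∀ x → fin (+ 0) +∞ x ≡ x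
+∞-identityˡ (fin k) = ≡.cong fin (ℤₚ.+-identityˡ k)
+∞-identityˡ ∞       = ≡.refl

x+∞x≡0⇒x≡0 : ∀ x → x +∞ x ≡ fin (+ 0) → x ≡ fin (+ 0)
x+∞x≡0⇒x≡0 (fin (+ zero))  _  = ≡.refl
x+∞x≡0⇒x≡0 (fin (+ suc n)) ()
x+∞x≡0⇒x≡0 (fin -[1+ n ])  ()
x+∞x≡0⇒x≡0 ∞               ()

fin≤∞∧suc≰∞⇒≡ : ∀ {b x} → fin b ≤∞ x → ¬ fin (ℤ.suc b) ≤∞ x → x ≡ fin b
fin≤∞∧suc≰∞⇒≡ (_ ≤∞∞) b+1≰∞ = ⊥-elim (b+1≰∞ (_ ≤∞∞))
fin≤∞∧suc≰∞⇒≡ {b} {fin n} (fin≤fin b≤n) b+1≰n with n ℤₚ.≟ b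
... | yes n≡b = ≡.cong fin n≡b
... | no  n≢b = ⊥-elim (b+1≰n (fin≤fin (ℤₚ.i<j⇒suc[i]≤j (ℤₚ.≤∧≢⇒< b≤n (λ b≡n → n≢b (≡.sym b≡n))))))

fin≤∞⊎< : ∀ m x → fin m ≤∞ x ⊎ Σ ℤ λ n → x ≡ fin n × n < m
fin≤∞⊎< m ∞       = inj₁ (_ ≤∞∞)
fin≤∞⊎< m (fin n) with m ℤₚ.≤? n
... | yes m≤n = inj₁ (fin≤fin m≤n)
... | no  m≰n = inj₂ (n , ≡.refl , ℤₚ.≰⇒> m≰n)

fin-bounded-below : ∀ x → Σ ℕ λ n → fin (ℤ.- (+ n)) ≤∞ x
fin-bounded-below (fin (+ n))    = 0 , fin≤fin (+≤+ z≤n)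
fin-bounded-below (fin -[1+ n ]) = suc n , fin≤fin ℤₚ.≤-refl
fin-bounded-below ∞              = 0 , _ ≤∞∞

1-[1+n]≡-n : ∀ n → + 1 ℤ.+ ℤ.- (+ suc n) ≡ ℤ.- (+ n)
1-[1+n]≡-n zero    = ≡.refl
1-[1+n]≡-n (suc n) = ≡.refl

fin≤∞⇒min∞≡fin : ∀ {b x} → fin b ≤∞ x → min∞ x (fin b) ≡ fin b
fin≤∞⇒min∞≡fin (fin≤fin b≤n) = ≡.cong fin (ℤₚ.i≥j⇒i⊓j≡j b≤n)
fin≤∞⇒min∞≡fin (_ ≤∞∞)       = ≡.refl

module CommutativeRingLemmas {c ℓ : Level} (R : CommutativeRing c ℓ) where
  open CommutativeRing R
  open import Algebra.Properties.Ring ring using (-0#≈0#; -‿+-comm; ⁻¹-anti-homo‿-)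
  open import Algebra.Solver.Ring.NaturalCoefficients.Default commutativeSemiring
  open import Relation.Binary.Reasoning.Setoid setoid

  −-congˡ : ∀ {x y y'} → y ≈ y' → x - y ≈ x - y'
  −-congˡ y≈y' = +-congˡ (-‿cong y≈y')

  −-cong : ∀ {x x' y y'} → x ≈ x' → y ≈ y' → x - y ≈ x' - y'
  −-cong x≈x' y≈y' = +-cong x≈x' (-‿cong y≈y')

  x−0≈x : ∀ x → x - 0# ≈ x
  x−0≈x x = trans (+-congˡ -0#≈0#) (+-identityʳ x)

  x+[y−x]≈y : ∀ x y → x + (y - x) ≈ y
  x+[y−x]≈y x y = begin
    x + (y + - x) ≈⟨ solve 3 (λ x y -x → x :+ (y :+ -x) := y :+ (x :+ -x)) refl x y (- x) ⟩
    y + (x + - x) ≈⟨ +-congˡ (-‿inverseʳ x) ⟩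
    y + 0#        ≈⟨ +-identityʳ y ⟩
    y             ∎

  [x+y]−x≈y : ∀ x y → (x + y) - x ≈ y
  [x+y]−x≈y x y = trans (+-assoc x y (- x)) (x+[y−x]≈y x y)

  [x+y]−y≈x : ∀ x y → (x + y) - y ≈ x
  [x+y]−y≈x x y = trans (+-congʳ (+-comm x y)) ([x+y]−x≈y y x)

  x−[x−y]≈y : ∀ x y → x - (x - y) ≈ y
  x−[x−y]≈y x y = trans (+-congˡ (⁻¹-anti-homo‿- x y)) (x+[y−x]≈y x y)

  [x−y]−[x−z]≈z−y : ∀ x y z → (x - y) - (x - z) ≈ z - y
  [x−y]−[x−z]≈z−y x y z = begin
    (x + - y) + - (x + - z) ≈⟨ +-congˡ (⁻¹-anti-homo‿- x z) ⟩
    (x + - y) + (z + - x)   ≈⟨ solve 4 (λ x -y z -x → (x :+ -y) :+ (z :+ -x) := (z :+ -y) :+ (x :+ -x)) refl x (- y) z (- x) ⟩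
    (z + - y) + (x + - x)   ≈⟨ +-congˡ (-‿inverseʳ x) ⟩
    (z + - y) + 0#          ≈⟨ +-identityʳ _ ⟩
    z + - y                 ∎

  x−[y+z]≈[x−z]−y : ∀ x y z → x - (y + z) ≈ (x - z) - y
  x−[y+z]≈[x−z]−y x y z = begin
    x + - (y + z)    ≈⟨ +-congˡ (sym (-‿+-comm y z)) ⟩
    x + (- y + - z)  ≈⟨ solve 3 (λ x -y -z → x :+ (-y :+ -z) := (x :+ -z) :+ -y) refl x (- y) (- z) ⟩
    (x + - z) + - y  ∎

  [x+z]−[y+w]≈[x−y]+[z−w] : ∀ x y z w → (x + z) - (y + w) ≈ (x - y) + (z - w)
  [x+z]−[y+w]≈[x−y]+[z−w] x y z w = begin
    (x + z) + - (y + w)   ≈⟨ +-congˡ (sym (-‿+-comm y w)) ⟩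
    (x + z) + (- y + - w) ≈⟨ solve 4 (λ x z -y -w → (x :+ z) :+ (-y :+ -w) := (x :+ -y) :+ (z :+ -w)) refl x z (- y) (- w) ⟩
    (x + - y) + (z + - w) ∎

  x≈1⇒y*x≈y : ∀ {x} y → x ≈ 1# → y * x ≈ y
  x≈1⇒y*x≈y y x≈1 = trans (*-congˡ x≈1) (*-identityʳ y)

  x*y≈1⇒[z*x]*y≈z : ∀ {x y} z → x * y ≈ 1# → (z * x) * y ≈ z
  x*y≈1⇒[z*x]*y≈z {x} {y} z xy≈1 = trans (*-assoc z x y) (x≈1⇒y*x≈y z xy≈1)

  x*y≈1⇒x*[y*z]≈z : ∀ {x y} z → x * y ≈ 1# → x * (y * z) ≈ z
  x*y≈1⇒x*[y*z]≈z {x} {y} z xy≈1 = trans (sym (*-assoc x y z)) (trans (*-congʳ xy≈1) (*-identityˡ z))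

module LocalField {c ℓ : Level} (𝔉 : NALocalField c ℓ) where
  open LF 𝔉
  open CommutativeRingLemmas commutativeRing
  open import Algebra.Properties.Ring ring
    using (-1*x≈-x; -‿involutive; x[y-z]≈xy-xz; [y-z]x≈yx-zx; ⁻¹-anti-homo‿-)
  open import Algebra.Properties.CommutativeSemigroup *-commutativeSemigroup
    using (x∙yz≈y∙xz; xy∙z≈xz∙y)
  open import Algebra.Solver.Ring.NaturalCoefficients.Default commutativeSemiring
  open import Relation.Binary.Reasoning.Setoid setoid

  infix 4 _≤ᵥ_
  _≤ᵥ_ : ℤ → Carrier → Set
  k ≤ᵥ x = fin k ≤∞ val x

  IsUnit : Carrier → Set
  IsUnit u = val u ≡ fin (+ 0)

  val≡fin⇒≉0 : ∀ {x k} → val x ≡ fin k → ¬ x ≈ 0#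
  val≡fin⇒≉0 vx x≈0 with ≡.trans (≡.sym vx) (≡.trans (val-cong x≈0) val-0)
  ... | ()

  ≉0⇒val≡fin : ∀ x → ¬ x ≈ 0# → Σ ℤ λ k → val x ≡ fin k
  ≉0⇒val≡fin x x≉0 with val x in vx
  ... | fin k = k , ≡.refl
  ... | ∞     = ⊥-elim (x≉0 (val-∞⇒0 x vx))

  val-*-fin : ∀ {x y k m} → val x ≡ fin k → val y ≡ fin m → val (x * y) ≡ fin (k ℤ.+ m)
  val-*-fin {x} {y} vx vy = ≡.trans (val-* x y) (≡.cong₂ _+∞_ vx vy)

  val-1 : IsUnit 1#
  val-1 with ≉0⇒val≡fin 1# 1≉0
  ... | k , v1 = ≡.trans v1 (≡.cong fin (identityˡ-unique k k (fin-injective k+k≡k)))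
    where
    k+k≡k : fin (k ℤ.+ k) ≡ fin k
    k+k≡k = ≡.trans (≡.sym (val-*-fin v1 v1)) (≡.trans (val-cong (*-identityˡ 1#)) v1)

  val-unit-* : ∀ {u} x → IsUnit u → val (u * x) ≡ val x
  val-unit-* {u} x vu = ≡.trans (val-* u x) (≡.trans (≡.cong (_+∞ val x) vu) (+∞-identityˡ (val x)))

  val-−1 : IsUnit (- 1#)
  val-−1 = x+∞x≡0⇒x≡0 (val (- 1#)) (≡.trans (≡.sym (val-* (- 1#) (- 1#))) (≡.trans (val-cong -1*-1≈1) val-1))
    where
    -1*-1≈1 : - 1# * - 1# ≈ 1#
    -1*-1≈1 = trans (-1*x≈-x (- 1#)) (-‿involutive 1#)

  val-neg : ∀ x → val (- x) ≡ val x
  val-neg x = ≡.trans (val-cong (sym (-1*x≈-x x))) (val-unit-* x val-−1)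

  val-⁻¹ : ∀ {x k} → val x ≡ fin k → val (x ⁻¹) ≡ fin (ℤ.- k)
  val-⁻¹ {x} {k} vx = -k-unique (val (x ⁻¹)) k+v≡0
    where
    k+v≡0 : fin k +∞ val (x ⁻¹) ≡ fin (+ 0)
    k+v≡0 = ≡.trans (≡.cong (_+∞ val (x ⁻¹)) (≡.sym vx))
              (≡.trans (≡.sym (val-* x (x ⁻¹))) (≡.trans (val-cong (inverseʳ x (val≡fin⇒≉0 vx))) val-1))
    -k-unique : ∀ v → fin k +∞ v ≡ fin (+ 0) → v ≡ fin (ℤ.- k)
    -k-unique (fin m) k+m≡0 = ≡.cong fin (inverseʳ-unique k m (fin-injective k+m≡0))
    -k-unique ∞       ()

  unit-* : ∀ {u v} → IsUnit u → IsUnit v → IsUnit (u * v)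
  unit-* = val-*-fin

  unit-⁻¹ : ∀ {u} → IsUnit u → IsUnit (u ⁻¹)
  unit-⁻¹ = val-⁻¹

  unit-*-⁻¹ : ∀ {u} → IsUnit u → u * u ⁻¹ ≈ 1#
  unit-*-⁻¹ {u} vu = inverseʳ u (val≡fin⇒≉0 vu)

  ≤ᵥ-cong : ∀ {k x y} → x ≈ y → k ≤ᵥ x → k ≤ᵥ y
  ≤ᵥ-cong {k} x≈y = ≡.subst (fin k ≤∞_) (val-cong x≈y)

  ≤ᵥ-weaken : ∀ {j k x} → j ≤ k → k ≤ᵥ x → j ≤ᵥ x
  ≤ᵥ-weaken j≤k = ≤∞-trans (fin≤fin j≤k)

  val≡⇒≤ᵥ : ∀ {k x} → val x ≡ fin k → k ≤ᵥ x
  val≡⇒≤ᵥ {k} vx = ≡.subst (fin k ≤∞_) (≡.sym vx) (fin≤fin ℤₚ.≤-refl)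

  ≤ᵥ-0# : ∀ {k} → k ≤ᵥ 0#
  ≤ᵥ-0# {k} = ≡.subst (fin k ≤∞_) (≡.sym val-0) (fin k ≤∞∞)

  ≤ᵥ-+ : ∀ {k} x y → k ≤ᵥ x → k ≤ᵥ y → k ≤ᵥ x + y
  ≤ᵥ-+ x y k≤x k≤y = ≤∞-trans (fin≤∞-min∞ k≤x k≤y) (val-+ x y)

  ≤ᵥ-neg : ∀ {k} x → k ≤ᵥ x → k ≤ᵥ - x
  ≤ᵥ-neg {k} x = ≡.subst (fin k ≤∞_) (≡.sym (val-neg x))

  ≤ᵥ-− : ∀ {k} x y → k ≤ᵥ x → k ≤ᵥ y → k ≤ᵥ x - y
  ≤ᵥ-− x y k≤x k≤y = ≤ᵥ-+ x (- y) k≤x (≤ᵥ-neg y k≤y)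

  ≤ᵥ-−-comm : ∀ {k} x y → k ≤ᵥ x - y → k ≤ᵥ y - x
  ≤ᵥ-−-comm x y k≤x−y = ≤ᵥ-cong (⁻¹-anti-homo‿- x y) (≤ᵥ-neg _ k≤x−y)

  ≤ᵥ-* : ∀ {k m} x y → k ≤ᵥ x → m ≤ᵥ y → k ℤ.+ m ≤ᵥ x * y
  ≤ᵥ-* {k} {m} x y k≤x m≤y = ≡.subst (fin (k ℤ.+ m) ≤∞_) (≡.sym (val-* x y)) (fin≤∞-+∞ k≤x m≤y)

  ≤ᵥ-unit-* : ∀ {k u} x → IsUnit u → k ≤ᵥ x → k ≤ᵥ u * x
  ≤ᵥ-unit-* {k} x vu = ≡.subst (fin k ≤∞_) (≡.sym (val-unit-* x vu))

  ≤ᵥ-unit-*⁻¹ : ∀ {k u} x → IsUnit u → k ≤ᵥ u * x → k ≤ᵥ x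
  ≤ᵥ-unit-*⁻¹ {k} x vu = ≡.subst (fin k ≤∞_) (val-unit-* x vu)

  ≤ᵥ-⊓-split : ∀ {j k} x → j ⊓ k ≤ᵥ x → Σ Carrier λ x₁ → Σ Carrier λ x₂ → x ≈ x₁ + x₂ × j ≤ᵥ x₁ × k ≤ᵥ x₂
  ≤ᵥ-⊓-split {j} {k} x m≤x with j ℤₚ.≤? k
  ... | yes j≤k = x , 0# , sym (+-identityʳ x) , ≡.subst (_≤ᵥ x) (ℤₚ.i≤j⇒i⊓j≡i j≤k) m≤x , ≤ᵥ-0#
  ... | no  j≰k = 0# , x , sym (+-identityˡ x) , ≤ᵥ-0# ,
                  ≡.subst (_≤ᵥ x) (ℤₚ.i≥j⇒i⊓j≡j (ℤₚ.<⇒≤ (ℤₚ.≰⇒> j≰k))) m≤x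

  val-+-strict : ∀ {b m} t r → val t ≡ fin b → m ≤ᵥ r → b < m → val (t + r) ≡ fin b
  val-+-strict {b} t r vt m≤r b<m = fin≤∞∧suc≰∞⇒≡ b≤t+r b+1≰t+r
    where
    b+1≤r : ℤ.suc b ≤ᵥ r
    b+1≤r = ≤ᵥ-weaken (ℤₚ.i<j⇒suc[i]≤j b<m) m≤r
    b≤t+r : b ≤ᵥ t + r
    b≤t+r = ≤ᵥ-+ t r (val≡⇒≤ᵥ vt) (≤ᵥ-weaken (ℤₚ.<⇒≤ b<m) m≤r)
    b+1≰t+r : ¬ ℤ.suc b ≤ᵥ t + r
    b+1≰t+r b+1≤t+r with ≡.subst (fin (ℤ.suc b) ≤∞_) vt (≤ᵥ-cong ([x+y]−y≈x t r) (≤ᵥ-− (t + r) r b+1≤t+r b+1≤r))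
    ... | fin≤fin b+1≤b = ℤₚ.<-irrefl ≡.refl (ℤₚ.suc[i]≤j⇒i<j b+1≤b)

  ^ₙ-*-inverse : ∀ {x y} n → x * y ≈ 1# → x ^ₙ n * y ^ₙ n ≈ 1#
  ^ₙ-*-inverse zero _ = *-identityˡ 1#
  ^ₙ-*-inverse {x} {y} (suc n) xy≈1 = begin
    (x * x ^ₙ n) * (y * y ^ₙ n) ≈⟨ solve 4 (λ x xⁿ y yⁿ → (x :* xⁿ) :* (y :* yⁿ) := (x :* y) :* (xⁿ :* yⁿ)) refl x (x ^ₙ n) y (y ^ₙ n) ⟩
    (x * y) * (x ^ₙ n * y ^ₙ n) ≈⟨ *-cong xy≈1 (^ₙ-*-inverse n xy≈1) ⟩
    1# * 1#                     ≈⟨ *-identityˡ 1# ⟩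
    1#                          ∎

  π*π⁻¹≈1 : π * π ⁻¹ ≈ 1#
  π*π⁻¹≈1 = inverseʳ π (val≡fin⇒≉0 val-π)

  π^-inverseʳ : ∀ k → π^ k * π^ (ℤ.- k) ≈ 1#
  π^-inverseʳ (+ zero)  = ^ₙ-*-inverse 0 π*π⁻¹≈1
  π^-inverseʳ (+ suc n) = ^ₙ-*-inverse (suc n) π*π⁻¹≈1
  π^-inverseʳ -[1+ n ]  = trans (*-comm _ _) (^ₙ-*-inverse (suc n) π*π⁻¹≈1)

  π^-inverseˡ : ∀ k → π^ (ℤ.- k) * π^ k ≈ 1#
  π^-inverseˡ k = trans (*-comm _ _) (π^-inverseʳ k)

  val-π^ₙ : ∀ n → val (π ^ₙ n) ≡ fin (+ n)
  val-π^ₙ zero    = val-1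
  val-π^ₙ (suc n) = val-*-fin val-π (val-π^ₙ n)

  val-π⁻¹^ₙ : ∀ n → val ((π ⁻¹) ^ₙ suc n) ≡ fin -[1+ n ]
  val-π⁻¹^ₙ zero    = val-*-fin (val-⁻¹ val-π) val-1
  val-π⁻¹^ₙ (suc n) = val-*-fin (val-⁻¹ val-π) (val-π⁻¹^ₙ n)

  val-π^ : ∀ k → val (π^ k) ≡ fin k
  val-π^ (+ n)    = val-π^ₙ n
  val-π^ -[1+ n ] = val-π⁻¹^ₙ n

  val-unit*π^ : ∀ {u x} k → IsUnit u → x ≈ u * π^ k → val x ≡ fin k
  val-unit*π^ k vu x≈uπᵏ = ≡.trans (val-cong x≈uπᵏ) (≡.trans (val-unit-* _ vu) (val-π^ k))

  unit-*π^⁻ : ∀ {x k} → val x ≡ fin k → IsUnit (x * π^ (ℤ.- k))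
  unit-*π^⁻ {k = k} vx = ≡.trans (val-*-fin vx (val-π^ (ℤ.- k))) (≡.cong fin (ℤₚ.+-inverseʳ k))

  ≤ᵥ-*π^ : ∀ {j} k x → j ≤ᵥ x → j ℤ.+ k ≤ᵥ x * π^ k
  ≤ᵥ-*π^ k x j≤x = ≤ᵥ-* x (π^ k) j≤x (val≡⇒≤ᵥ (val-π^ k))

  ≤ᵥ⇒InO-*π^⁻ : ∀ {k} x → k ≤ᵥ x → InO (x * π^ (ℤ.- k))
  ≤ᵥ⇒InO-*π^⁻ {k} x k≤x = ≡.subst (_≤ᵥ x * π^ (ℤ.- k)) (ℤₚ.+-inverseʳ k) (≤ᵥ-*π^ (ℤ.- k) x k≤x)

  InO⇒≤ᵥ-*π^ : ∀ k x → InO x → k ≤ᵥ x * π^ k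
  InO⇒≤ᵥ-*π^ k x 0≤x = ≡.subst (_≤ᵥ x * π^ k) (ℤₚ.+-identityˡ k) (≤ᵥ-*π^ k x 0≤x)

  InO∧InO⁻¹⇒IsUnit : ∀ {u} → ¬ u ≈ 0# → InO u → InO (u ⁻¹) → IsUnit u
  InO∧InO⁻¹⇒IsUnit {u} u≉0 0≤u 0≤u⁻¹ with ≉0⇒val≡fin u u≉0
  ... | k , vu with ≡.subst (fin (+ 0) ≤∞_) vu 0≤u | ≡.subst (fin (+ 0) ≤∞_) (val-⁻¹ vu) 0≤u⁻¹
  ...   | fin≤fin 0≤k | fin≤fin 0≤-k = ≡.trans vu (≡.cong fin (ℤₚ.≤-antisym (ℤₚ.neg-cancel-≤ {+ 0} {k} 0≤-k) 0≤k))

  InK⇒ : ∀ {u v w} → InK (ut u v w) → IsUnit u × InO v × IsUnit w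
  InK⇒ ((u≉0 , w≉0) , (0≤u , 0≤v , 0≤w) , (0≤u⁻¹ , _ , 0≤w⁻¹)) =
    InO∧InO⁻¹⇒IsUnit u≉0 0≤u 0≤u⁻¹ , 0≤v , InO∧InO⁻¹⇒IsUnit w≉0 0≤w 0≤w⁻¹

  InK⇐ : ∀ {u v w} → IsUnit u → InO v → IsUnit w → InK (ut u v w)
  InK⇐ {v = v} vu 0≤v vw =
    (val≡fin⇒≉0 vu , val≡fin⇒≉0 vw) ,
    (val≡⇒≤ᵥ vu , 0≤v , val≡⇒≤ᵥ vw) ,
    (val≡⇒≤ᵥ (unit-⁻¹ vu) , ≤ᵥ-neg _ (≤ᵥ-* v _ 0≤v (val≡⇒≤ᵥ (unit-* (unit-⁻¹ vu) (unit-⁻¹ vw)))) , val≡⇒≤ᵥ (unit-⁻¹ vw))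

  -- In a left coset the unit in the (1,1) entry is forced to be x π^-a.
  InLC⇒ : ∀ {a β c x y z} → InLC (M a β c) (ut x y z) →
          val x ≡ fin a × val z ≡ fin c × c ≤ᵥ y - (x * π^ (ℤ.- a)) * β
  InLC⇒ {a} {β} {c} {x} {y} {z} (ut u v w , k∈K , x≈uπᵃ , y≈uβ+vπᶜ , z≈wπᶜ) with InK⇒ k∈K
  ... | vu , 0≤v , vw =
    val-unit*π^ a vu x≈uπᵃ , val-unit*π^ c vw z≈wπᶜ , ≤ᵥ-cong (sym y−uβ≈vπᶜ) (InO⇒≤ᵥ-*π^ c v 0≤v)
    where
    xπ⁻ᵃ≈u : x * π^ (ℤ.- a) ≈ u
    xπ⁻ᵃ≈u = trans (*-congʳ x≈uπᵃ) (x*y≈1⇒[z*x]*y≈z u (π^-inverseʳ a))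
    y−uβ≈vπᶜ : y - (x * π^ (ℤ.- a)) * β ≈ v * π^ c
    y−uβ≈vπᶜ = begin
      y - (x * π^ (ℤ.- a)) * β      ≈⟨ −-cong y≈uβ+vπᶜ (*-congʳ xπ⁻ᵃ≈u) ⟩
      (u * β + v * π^ c) - u * β    ≈⟨ [x+y]−x≈y (u * β) (v * π^ c) ⟩
      v * π^ c                      ∎

  InLC⇐ : ∀ {a β c x y z} → val x ≡ fin a → val z ≡ fin c → c ≤ᵥ y - (x * π^ (ℤ.- a)) * β →
          InLC (M a β c) (ut x y z)
  InLC⇐ {a} {β} {c} {x} {y} {z} vx vz c≤r =
    ut u (r * π^ (ℤ.- c)) (z * π^ (ℤ.- c)) ,
    InK⇐ (unit-*π^⁻ vx) (≤ᵥ⇒InO-*π^⁻ r c≤r) (unit-*π^⁻ vz) ,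
    sym (x*y≈1⇒[z*x]*y≈z x (π^-inverseˡ a)) ,
    sym (trans (+-congˡ (x*y≈1⇒[z*x]*y≈z r (π^-inverseˡ c))) (x+[y−x]≈y (u * β) y)) ,
    sym (x*y≈1⇒[z*x]*y≈z z (π^-inverseˡ c))
    where
    u : Carrier
    u = x * π^ (ℤ.- a)
    r : Carrier
    r = y - u * β

  InLC-unique : ∀ {a β β' c g} → InLC (M a β c) g → InLC (M a β' c) g → c ≤ᵥ β - β'
  InLC-unique {a} {β} {β'} {c} {ut x y z} lc lc' with InLC⇒ {a} {β} {c} lc | InLC⇒ {a} {β'} {c} lc'
  ... | vx , _ , c≤y−uβ | _ , _ , c≤y−uβ' =
    ≤ᵥ-unit-*⁻¹ (β - β') (unit-*π^⁻ vx) (≤ᵥ-cong uβ-diff (≤ᵥ-− _ _ c≤y−uβ' c≤y−uβ))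
    where
    u : Carrier
    u = x * π^ (ℤ.- a)
    uβ-diff : (y - u * β') - (y - u * β) ≈ u * (β - β')
    uβ-diff = trans ([x−y]−[x−z]≈z−y y (u * β') (u * β)) (sym (x[y-z]≈xy-xz u β β'))

  InDC⇒ : ∀ {a β c x y z} → InDC (M a β c) (ut x y z) →
          val x ≡ fin a × val z ≡ fin c × Σ Carrier λ s → IsUnit s × a ⊓ c ≤ᵥ y - s * β
  InDC⇒ {a} {β} {c} {x} {y} {z} (ut u₁ v₁ w₁ , ut u₂ v₂ w₂ , k₁∈K , k₂∈K , x≈ , y≈ , z≈)
    with InK⇒ k₁∈K | InK⇒ k₂∈K
  ... | vu₁ , 0≤v₁ , vw₁ | vu₂ , 0≤v₂ , vw₂ =
    val-unit*π^ a (unit-* vu₁ vu₂) (trans x≈ (xy∙z≈xz∙y u₁ (π^ a) u₂)) ,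
    val-unit*π^ c (unit-* vw₁ vw₂) (trans z≈ (xy∙z≈xz∙y w₁ (π^ c) w₂)) ,
    u₁ * w₂ , unit-* vu₁ vw₂ , ≤ᵥ-cong (sym y−sβ≈r) m≤r
    where
    r : Carrier
    r = (u₁ * v₂) * π^ a + (v₁ * w₂) * π^ c
    y−sβ≈r : y - (u₁ * w₂) * β ≈ r
    y−sβ≈r = trans (+-congʳ (trans y≈ (solve 7 (λ u₁ πᵃ v₂ β v₁ πᶜ w₂ →
                     (u₁ :* πᵃ) :* v₂ :+ (u₁ :* β :+ v₁ :* πᶜ) :* w₂
                       := (u₁ :* w₂) :* β :+ ((u₁ :* v₂) :* πᵃ :+ (v₁ :* w₂) :* πᶜ))
                     refl u₁ (π^ a) v₂ β v₁ (π^ c) w₂)))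
                   ([x+y]−x≈y _ r)
    m≤r : a ⊓ c ≤ᵥ r
    m≤r = ≤ᵥ-+ _ _ (≤ᵥ-weaken (ℤₚ.i⊓j≤i a c) (InO⇒≤ᵥ-*π^ a _ (≤ᵥ-* u₁ v₂ (val≡⇒≤ᵥ vu₁) 0≤v₂)))
                   (≤ᵥ-weaken (ℤₚ.i⊓j≤j a c) (InO⇒≤ᵥ-*π^ c _ (≤ᵥ-* v₁ w₂ 0≤v₁ (val≡⇒≤ᵥ vw₂))))

  -- Split y - s β = r₁ + r₂ with π^a | r₁ and π^c | r₂; then r₁ is absorbed on the right and r₂ on the left.
  InDC⇐ : ∀ {a β c x y z s} → val x ≡ fin a → val z ≡ fin c → IsUnit s → a ⊓ c ≤ᵥ y - s * β →
          InDC (M a β c) (ut x y z)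
  InDC⇐ {a} {β} {c} {x} {y} {z} {s} vx vz vs m≤r with ≤ᵥ-⊓-split (y - s * β) m≤r
  ... | r₁ , r₂ , r≈r₁+r₂ , a≤r₁ , c≤r₂ =
    ut u v₁ w₁ , ut 1# v₂ w₂ ,
    InK⇐ vu (≤ᵥ-* _ _ (≤ᵥ⇒InO-*π^⁻ r₂ c≤r₂) (val≡⇒≤ᵥ (unit-⁻¹ vw₂))) vw₁ ,
    InK⇐ val-1 (≤ᵥ-* _ _ (≤ᵥ⇒InO-*π^⁻ r₁ a≤r₁) (val≡⇒≤ᵥ (unit-⁻¹ vu))) vw₂ ,
    sym (trans (*-identityʳ _) (x*y≈1⇒[z*x]*y≈z x (π^-inverseˡ a))) ,
    sym y-entry ,
    sym z-entry
    where
    u w₁ w₂ v₁ v₂ : Carrier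
    u  = x * π^ (ℤ.- a)
    w₂ = s * u ⁻¹
    w₁ = (z * π^ (ℤ.- c)) * w₂ ⁻¹
    v₁ = (r₂ * π^ (ℤ.- c)) * w₂ ⁻¹
    v₂ = (r₁ * π^ (ℤ.- a)) * u ⁻¹
    vu : IsUnit u
    vu = unit-*π^⁻ vx
    vw₂ : IsUnit w₂
    vw₂ = unit-* vs (unit-⁻¹ vu)
    vw₁ : IsUnit w₁
    vw₁ = unit-* (unit-*π^⁻ vz) (unit-⁻¹ vw₂)
    w₂⁻¹*w₂≈1 : w₂ ⁻¹ * w₂ ≈ 1#
    w₂⁻¹*w₂≈1 = trans (*-comm _ _) (unit-*-⁻¹ vw₂)
    y-entry : (u * π^ a) * v₂ + (u * β + v₁ * π^ c) * w₂ ≈ y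
    y-entry = begin
      (u * π^ a) * v₂ + (u * β + v₁ * π^ c) * w₂
        ≈⟨ solve 11 (λ u πᵃ r₁ π⁻ᵃ u⁻¹ β r₂ π⁻ᶜ w₂⁻¹ πᶜ s →
             (u :* πᵃ) :* ((r₁ :* π⁻ᵃ) :* u⁻¹) :+ (u :* β :+ ((r₂ :* π⁻ᶜ) :* w₂⁻¹) :* πᶜ) :* (s :* u⁻¹)
               := r₁ :* ((πᵃ :* π⁻ᵃ) :* (u :* u⁻¹)) :+ (s :* β) :* (u :* u⁻¹)
                    :+ r₂ :* ((π⁻ᶜ :* πᶜ) :* (w₂⁻¹ :* (s :* u⁻¹))))
             refl u (π^ a) r₁ (π^ (ℤ.- a)) (u ⁻¹) β r₂ (π^ (ℤ.- c)) (w₂ ⁻¹) (π^ c) s ⟩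
      r₁ * ((π^ a * π^ (ℤ.- a)) * (u * u ⁻¹)) + (s * β) * (u * u ⁻¹)
        + r₂ * ((π^ (ℤ.- c) * π^ c) * (w₂ ⁻¹ * w₂))
        ≈⟨ +-cong (+-cong (x≈1⇒y*x≈y r₁ (trans (*-cong (π^-inverseʳ a) (unit-*-⁻¹ vu)) (*-identityˡ 1#)))
                          (x≈1⇒y*x≈y (s * β) (unit-*-⁻¹ vu)))
                  (x≈1⇒y*x≈y r₂ (trans (*-cong (π^-inverseˡ c) w₂⁻¹*w₂≈1) (*-identityˡ 1#))) ⟩
      r₁ + s * β + r₂
        ≈⟨ solve 3 (λ r₁ sβ r₂ → r₁ :+ sβ :+ r₂ := sβ :+ (r₁ :+ r₂)) refl r₁ (s * β) r₂ ⟩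
      s * β + (r₁ + r₂)   ≈⟨ +-congˡ (sym r≈r₁+r₂) ⟩
      s * β + (y - s * β) ≈⟨ x+[y−x]≈y (s * β) y ⟩
      y                   ∎
    z-entry : (w₁ * π^ c) * w₂ ≈ z
    z-entry = begin
      (((z * π^ (ℤ.- c)) * w₂ ⁻¹) * π^ c) * w₂
        ≈⟨ solve 5 (λ z π⁻ᶜ w₂⁻¹ πᶜ w₂ → ((z :* π⁻ᶜ) :* w₂⁻¹ :* πᶜ) :* w₂ := ((z :* π⁻ᶜ) :* πᶜ) :* (w₂⁻¹ :* w₂))
             refl z (π^ (ℤ.- c)) (w₂ ⁻¹) (π^ c) w₂ ⟩
      ((z * π^ (ℤ.- c)) * π^ c) * (w₂ ⁻¹ * w₂) ≈⟨ *-congʳ (x*y≈1⇒[z*x]*y≈z z (π^-inverseˡ c)) ⟩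
      z * (w₂ ⁻¹ * w₂)                         ≈⟨ x≈1⇒y*x≈y z w₂⁻¹*w₂≈1 ⟩
      z                                        ∎

  InDC⇒InB : ∀ a β c g → InDC (M a β c) g → InB g
  InDC⇒InB a β c (ut x y z) dc =
    let vx , vz , _ = InDC⇒ {a} {β} {c} {x} {y} {z} dc in val≡fin⇒≉0 vx , val≡fin⇒≉0 vz

  InDC-degenerate⇔ : ∀ {a β c x y z} → a ⊓ c ≤ᵥ β →
    InDC (M a β c) (ut x y z) ⇔ (val x ≡ fin a × val z ≡ fin c × a ⊓ c ≤ᵥ y)
  InDC-degenerate⇔ {a} {β} {c} {x} {y} {z} m≤β = mk⇔ to from
    where
    to : InDC (M a β c) (ut x y z) → val x ≡ fin a × val z ≡ fin c × a ⊓ c ≤ᵥ y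
    to dc =
      let vx , vz , s , vs , m≤r = InDC⇒ {a} {β} {c} {x} {y} {z} dc
      in vx , vz , ≤ᵥ-cong (x+[y−x]≈y (s * β) y) (≤ᵥ-+ (s * β) (y - s * β) (≤ᵥ-unit-* β vs m≤β) m≤r)
    from : val x ≡ fin a × val z ≡ fin c × a ⊓ c ≤ᵥ y → InDC (M a β c) (ut x y z)
    from (vx , vz , m≤y) = InDC⇐ vx vz val-1 (≤ᵥ-− y _ m≤y (≤ᵥ-unit-* β val-1 m≤β))

  InDC-π^min⇔InDC-0 : ∀ a b c → b ≡ a ⊓ c → ∀ g → InDC (M a (π^ b) c) g ⇔ InDC (M a 0# c) g
  InDC-π^min⇔InDC-0 a b c b≡m (ut x y z) =
    ⇔-sym (InDC-degenerate⇔ ≤ᵥ-0#) ⇔-∘ InDC-degenerate⇔ (≡.subst (_≤ᵥ π^ b) b≡m (val≡⇒≤ᵥ (val-π^ b)))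

  unit*π^-approximation : ∀ m y → Σ ℤ λ b → b ≤ m × Σ Carrier λ s → IsUnit s × m ≤ᵥ y - s * π^ b
  unit*π^-approximation m y with fin≤∞⊎< m (val y)
  ... | inj₁ m≤y =
    m , ℤₚ.≤-refl , 1# , val-1 , ≤ᵥ-− y _ m≤y (val≡⇒≤ᵥ (val-unit*π^ m val-1 refl))
  ... | inj₂ (n , vy , n<m) =
    n , ℤₚ.<⇒≤ n<m , y * π^ (ℤ.- n) , unit-*π^⁻ vy ,
    ≤ᵥ-cong (sym (trans (−-congˡ (x*y≈1⇒[z*x]*y≈z y (π^-inverseˡ n))) (-‿inverseʳ y))) ≤ᵥ-0#

  approximation⇒val≡ : ∀ {b m s y} → IsUnit s → b < m → m ≤ᵥ y - s * π^ b → val y ≡ fin b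
  approximation⇒val≡ {b} {s = s} {y} vs b<m m≤r =
    ≡.trans (val-cong (sym (x+[y−x]≈y (s * π^ b) y))) (val-+-strict _ _ (val-unit*π^ b vs refl) m≤r b<m)

  approximation-exponent-unique : ∀ {b m s y} → IsUnit s → b ≤ m → m ≤ᵥ y - s * π^ b →
                                  min∞ (val y) (fin m) ≡ fin b
  approximation-exponent-unique {b} {m} {s} {y} vs b≤m m≤r with b ℤₚ.≟ m
  ... | yes ≡.refl = fin≤∞⇒min∞≡fin (≤ᵥ-cong (x+[y−x]≈y (s * π^ b) y) (≤ᵥ-+ _ _ (val≡⇒≤ᵥ (val-unit*π^ b vs refl)) m≤r))
  ... | no  b≢m   = ≡.trans (≡.cong (λ v → min∞ v (fin m)) (approximation⇒val≡ vs (ℤₚ.≤∧≢⇒< b≤m b≢m) m≤r))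
                            (≡.cong fin (ℤₚ.i≤j⇒i⊓j≡i b≤m))

  B-covered : (g : UT) → InB g → Σ ℤ λ a → Σ ℤ λ b → Σ ℤ λ c → b ≤ a ⊓ c × InDC (M a (π^ b) c) g
  B-covered (ut x y z) (x≉0 , z≉0) with ≉0⇒val≡fin x x≉0 | ≉0⇒val≡fin z z≉0
  ... | a , vx | c , vz with unit*π^-approximation (a ⊓ c) y
  ...   | b , b≤m , s , vs , m≤r = a , b , c , b≤m , InDC⇐ vx vz vs m≤r

  InDC-π^-invariants : ∀ {a b c x y z} → b ≤ a ⊓ c → InDC (M a (π^ b) c) (ut x y z) →
                       val x ≡ fin a × val z ≡ fin c × min∞ (val y) (fin (a ⊓ c)) ≡ fin b
  InDC-π^-invariants {a} {b} {c} {x} {y} {z} b≤m dc =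
    let vx , vz , s , vs , m≤r = InDC⇒ {a} {π^ b} {c} {x} {y} {z} dc
    in vx , vz , approximation-exponent-unique {b} {a ⊓ c} {s} {y} vs b≤m m≤r

  double-cosets-disjoint : ∀ a b c a' b' c' g → b ≤ a ⊓ c → b' ≤ a' ⊓ c' →
    InDC (M a (π^ b) c) g → InDC (M a' (π^ b') c') g → a ≡ a' × b ≡ b' × c ≡ c'
  double-cosets-disjoint a b c a' b' c' (ut x y z) b≤m b'≤m' dc dc' =
    let vx  , vz  , vy  = InDC-π^-invariants {a} {b} {c} b≤m dc
        vx' , vz' , vy' = InDC-π^-invariants {a'} {b'} {c'} b'≤m' dc'
        a≡a' : a ≡ a'
        a≡a' = fin-injective (≡.trans (≡.sym vx) vx')
        c≡c' : c ≡ c'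
        c≡c' = fin-injective (≡.trans (≡.sym vz) vz')
    in a≡a' ,
       fin-injective (≡.trans (≡.sym vy) (≡.trans (≡.cong₂ (λ a c → min∞ (val y) (fin (a ⊓ c))) a≡a' c≡c') vy')) ,
       c≡c'

  module Representatives {p : Level} {A : Carrier → Set p} (rep : IsRepSystem A) where
    open IsRepSystem rep

    digits[0]≈0 : digits (0# ∷ []) ≈ 0#
    digits[0]≈0 = trans (*-congˡ (+-identityʳ 0#)) (zeroʳ _)

    digits-expansion : ∀ n x → ℤ.- (+ n) ≤ᵥ x → Σ (List Carrier) λ l → All A l × InO (x - digits l)
    digits-expansion zero x 0≤x = [] , [] , ≤ᵥ-− x 0# 0≤x ≤ᵥ-0#
    digits-expansion (suc n) x -n-1≤x
      with digits-expansion n (π * x) (≡.subst (_≤ᵥ π * x) (1-[1+n]≡-n n) (≤ᵥ-* π x (val≡⇒≤ᵥ val-π) -n-1≤x))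
    ... | l , l∈A , 0≤πx−d with covers (π * x - digits l) 0≤πx−d
    ...   | a , a∈A , πx−d≡a = a ∷ l , a∈A ∷ l∈A , ≤ᵥ-cong (sym x−d'≈) (≤ᵥ-* (π ⁻¹) _ (val≡⇒≤ᵥ (val-⁻¹ val-π)) πx−d≡a)
      where
      x−d'≈ : x - π ⁻¹ * (a + digits l) ≈ π ⁻¹ * ((π * x - digits l) - a)
      x−d'≈ = begin
        x - π ⁻¹ * (a + digits l)
          ≈⟨ +-congʳ (sym (x*y≈1⇒x*[y*z]≈z x (trans (*-comm _ _) π*π⁻¹≈1))) ⟩
        π ⁻¹ * (π * x) - π ⁻¹ * (a + digits l) ≈⟨ sym (x[y-z]≈xy-xz (π ⁻¹) (π * x) (a + digits l)) ⟩
        π ⁻¹ * (π * x - (a + digits l))        ≈⟨ *-congˡ (x−[y+z]≈[x−z]−y (π * x) a (digits l)) ⟩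
        π ⁻¹ * ((π * x - digits l) - a)        ∎

    A_B-covers : ∀ x → Σ Carrier λ α → InA_B A α × InO (x - α)
    A_B-covers x with fin-bounded-below (val x)
    ... | n , -n≤x with digits-expansion n x -n≤x
    ...   | []    , []        , 0≤x−0 =
      digits (0# ∷ []) , (0# , [] , zero∈A , [] , refl) , ≤ᵥ-cong (−-congˡ (sym digits[0]≈0)) 0≤x−0
    ...   | a ∷ l , a∈A ∷ l∈A , 0≤x−d = digits (a ∷ l) , (a , l , a∈A , l∈A , refl) , 0≤x−d

    -- Expansions that agree modulo 𝒪 have the same leading digit, as A represents 𝒪/(π) uniquely.
    digit-step : ∀ {a a' d d'} → A a → A a' → InO (π ⁻¹ * (a + d) - π ⁻¹ * (a' + d')) →
                 (InO (d - d') → d ≈ d') → π ⁻¹ * (a + d) ≈ π ⁻¹ * (a' + d')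
    digit-step {a} {a'} {d} {d'} a∈A a'∈A 0≤diff tail-unique = *-congˡ (+-cong a≈a' d≈d')
      where
      X≈ : (a + d) - (a' + d') ≈ (a - a') + (d - d')
      X≈ = [x+z]−[y+w]≈[x−y]+[z−w] a a' d d'
      1≤X : + 1 ≤ᵥ (a + d) - (a' + d')
      1≤X = ≤ᵥ-cong (trans (x[y-z]≈xy-xz π _ _) (−-cong (x*y≈1⇒x*[y*z]≈z _ π*π⁻¹≈1) (x*y≈1⇒x*[y*z]≈z _ π*π⁻¹≈1)))
                    (≤ᵥ-* π _ (val≡⇒≤ᵥ val-π) 0≤diff)
      0≤a−a' : InO (a - a')
      0≤a−a' = ≤ᵥ-− a a' (A⊆O a a∈A) (A⊆O a' a'∈A)
      d≈d' : d ≈ d'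
      d≈d' = tail-unique (≤ᵥ-cong ([x+y]−x≈y (a - a') (d - d'))
                                  (≤ᵥ-− _ _ (≤ᵥ-cong X≈ (≤ᵥ-weaken (+≤+ z≤n) 1≤X)) 0≤a−a'))
      a≈a' : a ≈ a'
      a≈a' = unique a a' a∈A a'∈A
               (≤ᵥ-cong (trans X≈ (trans (+-congˡ (trans (−-congˡ (sym d≈d')) (-‿inverseʳ d))) (+-identityʳ _))) 1≤X)

    digits≈0 : ∀ l → All A l → InO (digits l) → digits l ≈ 0#
    digits≈0 [] [] _ = refl
    digits≈0 (a ∷ l) (a∈A ∷ l∈A) 0≤d =
      trans (digit-step a∈A zero∈A (≤ᵥ-cong (sym (trans (−-congˡ digits[0]≈0) (x−0≈x _))) 0≤d)
                        (λ 0≤d−0 → digits≈0 l l∈A (≤ᵥ-cong (x−0≈x _) 0≤d−0)))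
            digits[0]≈0

    digits-unique : ∀ l l' → All A l → All A l' → InO (digits l - digits l') → digits l ≈ digits l'
    digits-unique [] [] [] [] _ = refl
    digits-unique (a ∷ l) (a' ∷ l') (a∈A ∷ l∈A) (a'∈A ∷ l'∈A) 0≤diff =
      digit-step a∈A a'∈A 0≤diff (digits-unique l l' l∈A l'∈A)
    digits-unique (a ∷ l) [] l∈A [] 0≤diff = digits≈0 (a ∷ l) l∈A (≤ᵥ-cong (x−0≈x _) 0≤diff)
    digits-unique [] (a' ∷ l') [] l'∈A 0≤diff =
      sym (digits≈0 (a' ∷ l') l'∈A (≤ᵥ-cong (x−0≈x _) (≤ᵥ-−-comm _ _ 0≤diff)))

    A_B-unique : ∀ {α α'} → InA_B A α → InA_B A α' → InO (α - α') → α ≈ α'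
    A_B-unique (a , l , a∈A , l∈A , α≈) (a' , l' , a'∈A , l'∈A , α'≈) 0≤diff =
      trans α≈ (trans (digits-unique (a ∷ l) (a' ∷ l') (a∈A ∷ l∈A) (a'∈A ∷ l'∈A) (≤ᵥ-cong (−-cong α≈ α'≈) 0≤diff))
                      (sym α'≈))

    0∈A_Bπ^ : ∀ k → InA_Bπ^ A k 0#
    0∈A_Bπ^ k = 0# , (0# , [] , zero∈A , [] , sym digits[0]≈0) , sym (zeroˡ (π^ k))

    A_Bπ^-covers : ∀ k x → Σ Carrier λ β → InA_Bπ^ A k β × k ≤ᵥ x - β
    A_Bπ^-covers k x with A_B-covers (x * π^ (ℤ.- k))
    ... | α , α∈A_B , 0≤diff = α * π^ k , (α , α∈A_B , refl) , ≤ᵥ-cong diff≈ (InO⇒≤ᵥ-*π^ k _ 0≤diff)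
      where
      diff≈ : (x * π^ (ℤ.- k) - α) * π^ k ≈ x - α * π^ k
      diff≈ = trans ([y-z]x≈yx-zx (π^ k) _ α) (+-congʳ (x*y≈1⇒[z*x]*y≈z x (π^-inverseˡ k)))

    A_Bπ^-unique : ∀ {k β β'} → InA_Bπ^ A k β → InA_Bπ^ A k β' → k ≤ᵥ β - β' → β ≈ β'
    A_Bπ^-unique {k} (α , α∈A_B , β≈) (α' , α'∈A_B , β'≈) k≤diff =
      trans β≈ (trans (*-congʳ (A_B-unique α∈A_B α'∈A_B 0≤α−α')) (sym β'≈))
      where
      0≤α−α' : InO (α - α')
      0≤α−α' = ≤ᵥ-cong (x*y≈1⇒[z*x]*y≈z _ (π^-inverseʳ k))
                 (≤ᵥ⇒InO-*π^⁻ _ (≤ᵥ-cong (trans (−-cong β≈ β'≈) (sym ([y-z]x≈yx-zx (π^ k) α α'))) k≤diff))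

    coset-representative-unique : ∀ a c {β β'} g → InA_Bπ^ A c β → InA_Bπ^ A c β' →
                                  InLC (M a β c) g → InLC (M a β' c) g → β ≈ β'
    coset-representative-unique a c {β} {β'} g β∈ β'∈ lc lc' = A_Bπ^-unique β∈ β'∈ (InLC-unique {a} {β} {β'} {c} lc lc')

    -- With u = x π^-a, g lies in K_B M(a, y u⁻¹, c); β is the representative of y u⁻¹ modulo π^c.
    left-coset-representative : ∀ {a c x y z} → val x ≡ fin a → val z ≡ fin c →
      Σ Carrier λ β → InA_Bπ^ A c β × c ≤ᵥ y * (x * π^ (ℤ.- a)) ⁻¹ - β × InLC (M a β c) (ut x y z)
    left-coset-representative {a} {c} {x} {y} {z} vx vz with A_Bπ^-covers c (y * (x * π^ (ℤ.- a)) ⁻¹)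
    ... | β , β∈ , c≤β₀−β = β , β∈ , c≤β₀−β , InLC⇐ vx vz (≤ᵥ-cong u[β₀−β]≈ (≤ᵥ-unit-* _ (unit-*π^⁻ vx) c≤β₀−β))
      where
      u : Carrier
      u = x * π^ (ℤ.- a)
      u[β₀−β]≈ : u * (y * u ⁻¹ - β) ≈ y - u * β
      u[β₀−β]≈ = trans (x[y-z]≈xy-xz u _ β)
                       (+-congʳ (trans (x∙yz≈y∙xz u y (u ⁻¹)) (x≈1⇒y*x≈y y (unit-*-⁻¹ (unit-*π^⁻ vx)))))

    generic-double-coset⇔ : ∀ a b c → b < a ⊓ c → ∀ g →
      InDC (M a (π^ b) c) g ⇔ Σ Carrier λ β → InA_Bπ^ A c β × val β ≡ fin b × InLC (M a β c) g
    generic-double-coset⇔ a b c b<m (ut x y z) = mk⇔ to from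
      where
      to : InDC (M a (π^ b) c) (ut x y z) → Σ Carrier λ β → InA_Bπ^ A c β × val β ≡ fin b × InLC (M a β c) (ut x y z)
      to dc =
        let vx , vz , s , vs , m≤r = InDC⇒ {a} {π^ b} {c} {x} {y} {z} dc
            β , β∈ , c≤β₀−β , lc  = left-coset-representative {a} {c} {x} {y} {z} vx vz
        in β , β∈ , representative-val vx vs m≤r c≤β₀−β , lc
        where
        representative-val : ∀ {s β} → val x ≡ fin a → IsUnit s → a ⊓ c ≤ᵥ y - s * π^ b →
                             c ≤ᵥ y * (x * π^ (ℤ.- a)) ⁻¹ - β → val β ≡ fin b
        representative-val {s} {β} vx vs m≤r c≤β₀−β =
          ≡.trans (val-cong (sym (x−[x−y]≈y β₀ β)))
                  (val-+-strict β₀ _ vβ₀ (≤ᵥ-neg _ c≤β₀−β) (ℤₚ.<-≤-trans b<m (ℤₚ.i⊓j≤j a c)))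
          where
          β₀ : Carrier
          β₀ = y * (x * π^ (ℤ.- a)) ⁻¹
          vβ₀ : val β₀ ≡ fin b
          vβ₀ = ≡.trans (val-cong (*-comm _ _))
                        (≡.trans (val-unit-* y (unit-⁻¹ (unit-*π^⁻ vx))) (approximation⇒val≡ {b} {a ⊓ c} {s} {y} vs b<m m≤r))
      from : (Σ Carrier λ β → InA_Bπ^ A c β × val β ≡ fin b × InLC (M a β c) (ut x y z)) → InDC (M a (π^ b) c) (ut x y z)
      from (β , _ , vβ , lc) with InLC⇒ {a} {β} {c} lc
      ... | vx , vz , c≤y−uβ =
        InDC⇐ vx vz (unit-* (unit-*π^⁻ vx) (unit-*π^⁻ vβ))
          (≤ᵥ-weaken (ℤₚ.i⊓j≤j a c) (≤ᵥ-cong (−-congˡ (sym (trans (*-assoc _ _ _) (*-congˡ (x*y≈1⇒[z*x]*y≈z β (π^-inverseˡ b))))))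
                                               c≤y−uβ))

    degenerate-double-coset⇔ : ∀ a c g →
      InDC (M a 0# c) g ⇔ Σ Carrier λ β → InA_Bπ^ A c β × fin a ≤∞ val β × InLC (M a β c) g
    degenerate-double-coset⇔ a c (ut x y z) = mk⇔ to from
      where
      to : InDC (M a 0# c) (ut x y z) → Σ Carrier λ β → InA_Bπ^ A c β × a ≤ᵥ β × InLC (M a β c) (ut x y z)
      to dc =
        let vx , vz , m≤y = Equivalence.to (InDC-degenerate⇔ {a} {0#} {c} {x} {y} {z} ≤ᵥ-0#) dc
        in representative vx vz m≤y (a ℤₚ.≤? c)
        where
        representative : val x ≡ fin a → val z ≡ fin c → a ⊓ c ≤ᵥ y → Dec (a ≤ c) →
                         Σ Carrier λ β → InA_Bπ^ A c β × a ≤ᵥ β × InLC (M a β c) (ut x y z)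
        representative vx vz m≤y (yes a≤c) =
          let β , β∈ , c≤β₀−β , lc = left-coset-representative {a} {c} {x} {y} {z} vx vz
              a≤β₀ : a ≤ᵥ y * (x * π^ (ℤ.- a)) ⁻¹
              a≤β₀ = ≤ᵥ-cong (*-comm _ _) (≤ᵥ-unit-* y (unit-⁻¹ (unit-*π^⁻ vx)) (≡.subst (_≤ᵥ y) (ℤₚ.i≤j⇒i⊓j≡i a≤c) m≤y))
          in β , β∈ , ≤ᵥ-cong (x−[x−y]≈y _ β) (≤ᵥ-− _ _ a≤β₀ (≤ᵥ-weaken a≤c c≤β₀−β)) , lc
        representative vx vz m≤y (no a≰c) =
          0# , 0∈A_Bπ^ c , ≤ᵥ-0# ,
          InLC⇐ vx vz (≤ᵥ-cong (sym (trans (−-congˡ (zeroʳ _)) (x−0≈x y)))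
                               (≡.subst (_≤ᵥ y) (ℤₚ.i≥j⇒i⊓j≡j (ℤₚ.<⇒≤ (ℤₚ.≰⇒> a≰c))) m≤y))
      from : (Σ Carrier λ β → InA_Bπ^ A c β × a ≤ᵥ β × InLC (M a β c) (ut x y z)) → InDC (M a 0# c) (ut x y z)
      from (β , _ , a≤β , lc) with InLC⇒ {a} {β} {c} lc
      ... | vx , vz , c≤y−uβ = Equivalence.from (InDC-degenerate⇔ {a} {0#} {c} {x} {y} {z} ≤ᵥ-0#) (vx , vz , m≤y)
        where
        m≤y : a ⊓ c ≤ᵥ y
        m≤y = ≤ᵥ-cong (x+[y−x]≈y _ y) (≤ᵥ-+ _ _ (≤ᵥ-weaken (ℤₚ.i⊓j≤i a c) (≤ᵥ-unit-* β (unit-*π^⁻ vx) a≤β))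
                                                (≤ᵥ-weaken (ℤₚ.i⊓j≤j a c) c≤y−uβ))

lemmaA1 : ∀ {c ℓ p : Level} (𝔉 : NALocalField c ℓ) →
    let open LF 𝔉 in
    (A : Carrier → Set p) → IsRepSystem A →
    ((g : UT) → InB g →
      Σ ℤ λ a → Σ ℤ λ b → Σ ℤ λ c → b ≤ a ⊓ c × InDC (M a (π^ b) c) g)
    × (∀ a b c g → InDC (M a (π^ b) c) g → InB g)
    × (∀ a b c a' b' c' g → b ≤ a ⊓ c → b' ≤ a' ⊓ c' →
        InDC (M a (π^ b) c) g → InDC (M a' (π^ b') c') g →
        a ≡ a' × b ≡ b' × c ≡ c')
    × (∀ a b c → b < a ⊓ c →
        (∀ g → InDC (M a (π^ b) c) g ⇔
           Σ Carrier λ β → InA_Bπ^ A c β × val β ≡ fin b × InLC (M a β c) g)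
        × (∀ β β' g → InA_Bπ^ A c β → val β ≡ fin b →
             InA_Bπ^ A c β' → val β' ≡ fin b →
             InLC (M a β c) g → InLC (M a β' c) g → β ≈ β'))
    × (∀ a b c → b ≡ a ⊓ c →
        (∀ g → InDC (M a (π^ b) c) g ⇔ InDC (M a 0# c) g)
        × (∀ g → InDC (M a 0# c) g ⇔
             Σ Carrier λ β → InA_Bπ^ A c β × fin a ≤∞ val β × InLC (M a β c) g)
        × (∀ β β' g → InA_Bπ^ A c β → fin a ≤∞ val β →
             InA_Bπ^ A c β' → fin a ≤∞ val β' →
             InLC (M a β c) g → InLC (M a β' c) g → β ≈ β'))
lemmaA1 𝔉 A rep =
  B-covered ,
  (λ a b c → InDC⇒InB a (π^ b) c) ,
  double-cosets-disjoint ,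
  (λ a b c b<m → generic-double-coset⇔ a b c b<m , λ β β' g β∈ _ β'∈ _ → coset-representative-unique a c g β∈ β'∈) ,
  (λ a b c b≡m → InDC-π^min⇔InDC-0 a b c b≡m , degenerate-double-coset⇔ a c ,
                 λ β β' g β∈ _ β'∈ _ → coset-representative-unique a c g β∈ β'∈)
  where
  open LF 𝔉
  open LocalField 𝔉
  open Representatives rep
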